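{- Consider the Fitch-style calculus for Intuitionistic S4 interpreted in a cartesian closed category $\mathcal{C}$ with an adjunction $\Diamond\dashv\Box$ in which $\Box$ is an idempotent comonad. Let $D$ be a derivation of $\Gamma,\Gamma'\vdash t:\Box A$ such that no variable of $\Gamma'$ is free in $t$, let $D'$ be the derivation of $\Gamma\vdash t:\Box A$ obtained by strengthening away $\Gamma'$, and let $\Gamma''$ be any context with $\Gamma,\Gamma',\Gamma''$ well formed. Let $E$ be the derivation of $\Gamma,\Gamma',\Gamma''\vdash\mathrm{open}\,t:A$ obtained by applying the open rule to $D$ with weakening $\Gamma''$, and $E'$ the derivation of the same judgement obtained by applying the open rule to $D'$ with weakening $\Gamma',\Gamma''$. Then $[\![E]\!]=[\![E']\!]$.
   Context: Calculus: types $A,B ::= p \mid 1 \mid A\times B \mid A\to B \mid \Box A$; contexts $\Gamma ::= \cdot \mid \Gamma,x:A \mid \Gamma,\bullet$ ($\bullet$ a structural symbol called a lock). Rules: (var) $\Gamma,x:A,\Gamma'\vdash x:A$ provided $\Gamma'$ contains no lock; usual rules for $1,\times,\to$; (shut) from $\Gamma,\bullet\vdash t:A$ infer $\Gamma\vdash\mathrm{shut}\,t:\Box A$; (open) from $\Gamma\vdash t:\Box A$ infer $\Gamma,\Gamma_0\vdash\mathrm{open}\,t:A$ for any context $\Gamma_0$ (called the weakening). Strengthening: if $D$ derives $\Gamma,\Delta,\Gamma_1\vdash t:B$ and no variable of $\Delta$ is free in $t$, the strengthened derivation of $\Gamma,\Gamma_1\vdash t:B$ is obtained by deleting these occurrences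 of the entries of $\Delta$ (variables and locks) from every sequent of $D$ in which they occur. Semantics: $(\Diamond,\eta,\mu)$ is the monad induced by the comonad $\Box$ via the adjunction (unit $\eta^m$, counit $\varepsilon^m$); idempotence means each $\mu_X$ is an isomorphism with inverse $\eta_{\Diamond X}=\Diamond\eta_X$. Types are interpreted via the cartesian closed structure and $\Box$ (atoms arbitrary). A context $\Gamma$ denotes an endofunctor: $[\![\cdot]\!]=\mathrm{Id}$, $[\![\Gamma,x:A]\!](X)=[\![\Gamma]\!](X)\times[\![A]\!]$, $[\![\Gamma,\bullet]\!](X)=\Diamond[\![\Gamma]\!](X)$, and the object $[\![\Gamma]\!]=[\![\Gamma]\!](1)$, so $[\![\Gamma,\Gamma']\!]=[\![\Gamma']\!]([\![\Gamma]\!])$. Lock replacement $l_\Gamma:[\![\Gamma]\!]\Rightarrow\Diamond$: $l_\cdot=\eta$, $(l_{\Gamma,x:A})_X=(l_\Gamma)_X\circ\mathrm{pr}$, $(l_{\Gamma,\bullet})_X=\mu_X\circ\Diamond(l_\Gamma)_X$. A derivation $D$ of $\Gamma\vdash t:A$ denotes $[\![D]\!]:[\![\Gamma]\!]\to[\![A]\!]$ by induction: variables by projections, $1,\times,\to$ by the cartesian closed structure, $[\![\mathrm{shut}\,t]\!]=\Box[\![t]\!]\circ\eta^m_{[\![\Gamma]\!]}$, and $[\![\Gamma,\Gamma_0\vdash\mathrm{open}\,t]\!]=\varepsilon^m_{[\![A]\!]}\circ\Diamond[\![t]\!]\circ(l_{\Gamma_0})_{[\![\Gamma]\!]}$. 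-}

module Defs where

open import Level using (Level; _⊔_) renaming (suc to lsuc)
open import Data.Nat using (ℕ)
open import Data.Unit using (⊤; tt)
open import Data.Bool using (T)
open import Data.Maybe using (Maybe; just; nothing; is-just; to-witness-T) renaming (map to mapMaybe)
open import Data.Product using (Σ; _×_; _,_; proj₁; proj₂)
open import Relation.Binary using (Rel; IsEquivalence)

record Model (o ℓ e : Level) : Set (lsuc (o ⊔ ℓ ⊔ e)) where
  infix  4 _≈_
  infixr 9 _∘_
  field
    Obj      : Set o
    Hom      : Obj → Obj → Set ℓ
    _≈_      : ∀ {X Y} → Rel (Hom X Y) e
    ≈-equiv  : ∀ {X Y} → IsEquivalence (_≈_ {X} {Y})
    id       : ∀ {X} → Hom X X
    _∘_      : ∀ {X Y Z} → Hom Y Z → Hom X Y → Hom X Z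
    ∘-resp-≈ : ∀ {X Y Z} {f f' : Hom Y Z} {g g' : Hom X Y} →
               f ≈ f' → g ≈ g' → f ∘ g ≈ f' ∘ g'
    identityˡ : ∀ {X Y} {f : Hom X Y} → id ∘ f ≈ f
    identityʳ : ∀ {X Y} {f : Hom X Y} → f ∘ id ≈ f
    assoc     : ∀ {W X Y Z} {f : Hom Y Z} {g : Hom X Y} {h : Hom W X} →
                (f ∘ g) ∘ h ≈ f ∘ (g ∘ h)

    ⊤ₒ       : Obj
    !        : ∀ {X} → Hom X ⊤ₒ
    !-unique : ∀ {X} (f : Hom X ⊤ₒ) → f ≈ !

    _×ₒ_      : Obj → Obj → Obj
    π₁        : ∀ {X Y} → Hom (X ×ₒ Y) X
    π₂        : ∀ {X Y} → Hom (X ×ₒ Y) Y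
    ⟨_,_⟩     : ∀ {W X Y} → Hom W X → Hom W Y → Hom W (X ×ₒ Y)
    π₁-β      : ∀ {W X Y} {f : Hom W X} {g : Hom W Y} → π₁ ∘ ⟨ f , g ⟩ ≈ f
    π₂-β      : ∀ {W X Y} {f : Hom W X} {g : Hom W Y} → π₂ ∘ ⟨ f , g ⟩ ≈ g
    ⟨⟩-unique : ∀ {W X Y} {f : Hom W X} {g : Hom W Y} {h : Hom W (X ×ₒ Y)} →
                π₁ ∘ h ≈ f → π₂ ∘ h ≈ g → h ≈ ⟨ f , g ⟩

    _⇨_          : Obj → Obj → Obj
    eval         : ∀ {Y Z} → Hom ((Y ⇨ Z) ×ₒ Y) Z
    curry        : ∀ {X Y Z} → Hom (X ×ₒ Y) Z → Hom X (Y ⇨ Z)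
    eval-curry   : ∀ {X Y Z} {f : Hom (X ×ₒ Y) Z} →
                   eval ∘ ⟨ curry f ∘ π₁ , π₂ ⟩ ≈ f
    curry-unique : ∀ {X Y Z} {f : Hom (X ×ₒ Y) Z} {h : Hom X (Y ⇨ Z)} →
                   eval ∘ ⟨ h ∘ π₁ , π₂ ⟩ ≈ f → h ≈ curry f

    □₀          : Obj → Obj
    □₁          : ∀ {X Y} → Hom X Y → Hom (□₀ X) (□₀ Y)
    □-identity  : ∀ {X} → □₁ (id {X}) ≈ id
    □-hom       : ∀ {X Y Z} {f : Hom Y Z} {g : Hom X Y} → □₁ (f ∘ g) ≈ □₁ f ∘ □₁ g
    □-resp-≈    : ∀ {X Y} {f g : Hom X Y} → f ≈ g → □₁ f ≈ □₁ g

    ◇₀          : Obj → Obj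
    ◇₁          : ∀ {X Y} → Hom X Y → Hom (◇₀ X) (◇₀ Y)
    ◇-identity  : ∀ {X} → ◇₁ (id {X}) ≈ id
    ◇-hom       : ∀ {X Y Z} {f : Hom Y Z} {g : Hom X Y} → ◇₁ (f ∘ g) ≈ ◇₁ f ∘ ◇₁ g
    ◇-resp-≈    : ∀ {X Y} {f g : Hom X Y} → f ≈ g → ◇₁ f ≈ ◇₁ g

    ηᵐ         : ∀ {X} → Hom X (□₀ (◇₀ X))
    εᵐ         : ∀ {X} → Hom (◇₀ (□₀ X)) X
    ηᵐ-natural : ∀ {X Y} {f : Hom X Y} → ηᵐ ∘ f ≈ □₁ (◇₁ f) ∘ ηᵐ
    εᵐ-natural : ∀ {X Y} {f : Hom X Y} → εᵐ ∘ ◇₁ (□₁ f) ≈ f ∘ εᵐ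
    zig        : ∀ {X} → εᵐ {◇₀ X} ∘ ◇₁ (ηᵐ {X}) ≈ id
    zag        : ∀ {X} → □₁ (εᵐ {X}) ∘ ηᵐ {□₀ X} ≈ id

    ε          : ∀ {X} → Hom (□₀ X) X
    δ          : ∀ {X} → Hom (□₀ X) (□₀ (□₀ X))
    ε-natural  : ∀ {X Y} {f : Hom X Y} → f ∘ ε ≈ ε ∘ □₁ f
    δ-natural  : ∀ {X Y} {f : Hom X Y} → □₁ (□₁ f) ∘ δ ≈ δ ∘ □₁ f
    comonad-idˡ : ∀ {X} → ε {□₀ X} ∘ δ {X} ≈ id
    comonad-idʳ : ∀ {X} → □₁ (ε {X}) ∘ δ {X} ≈ id
    comonad-assoc : ∀ {X} → δ {□₀ X} ∘ δ {X} ≈ □₁ (δ {X}) ∘ δ {X}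

    δ-iso : ∀ {X} → Σ (Hom (□₀ (□₀ X)) (□₀ X)) λ g →
            (g ∘ δ ≈ id) × (δ ∘ g ≈ id)

infixr 7 _⇒_
infixr 8 _⊗_
infixl 5 _▸_ _,,_

data Ty : Set where
  atom : ℕ → Ty
  𝟙    : Ty
  _⊗_  : Ty → Ty → Ty
  _⇒_  : Ty → Ty → Ty
  □    : Ty → Ty

-- contexts:  · | Γ , x : A | Γ , •     (de Bruijn: variables are positions)
data Ctx : Set where
  ∙    : Ctx
  _▸_  : Ctx → Ty → Ctx
  _▸🔒 : Ctx → Ctx

_,,_ : Ctx → Ctx → Ctx
Γ ,, ∙        = Γ
Γ ,, (Δ ▸ A)  = (Γ ,, Δ) ▸ A
Γ ,, (Δ ▸🔒)  = (Γ ,, Δ) ▸🔒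

-- Γ ≼ Γ' : Γ' is Γ , Γ₀ for some context Γ₀ (the weakening of the open rule)
data _≼_ : Ctx → Ctx → Set where
  ≼-refl : ∀ {Γ} → Γ ≼ Γ
  ≼-var  : ∀ {Γ Δ A} → Γ ≼ Δ → Γ ≼ (Δ ▸ A)
  ≼-lock : ∀ {Γ Δ} → Γ ≼ Δ → Γ ≼ (Δ ▸🔒)

≼-++ : ∀ Γ Δ → Γ ≼ (Γ ,, Δ)
≼-++ Γ ∙       = ≼-refl
≼-++ Γ (Δ ▸ A) = ≼-var (≼-++ Γ Δ)
≼-++ Γ (Δ ▸🔒) = ≼-lock (≼-++ Γ Δ)

≼-trans : ∀ {Γ Δ Θ} → Γ ≼ Δ → Δ ≼ Θ → Γ ≼ Θ
≼-trans w ≼-refl     = w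
≼-trans w (≼-var v)  = ≼-var (≼-trans w v)
≼-trans w (≼-lock v) = ≼-lock (≼-trans w v)

-- variables  Γ , x : A , Γ' ⊢ x : A  with Γ' lock-free
data Var : Ctx → Ty → Set where
  vz : ∀ {Γ A} → Var (Γ ▸ A) A
  vs : ∀ {Γ A B} → Var Γ A → Var (Γ ▸ B) A

infix 3 _⊢_
data _⊢_ : Ctx → Ty → Set where
  var  : ∀ {Γ A} → Var Γ A → Γ ⊢ A
  unit : ∀ {Γ} → Γ ⊢ 𝟙
  pair : ∀ {Γ A B} → Γ ⊢ A → Γ ⊢ B → Γ ⊢ A ⊗ B
  fst  : ∀ {Γ A B} → Γ ⊢ A ⊗ B → Γ ⊢ A
  snd  : ∀ {Γ A B} → Γ ⊢ A ⊗ B → Γ ⊢ B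
  lam  : ∀ {Γ A B} → Γ ▸ A ⊢ B → Γ ⊢ A ⇒ B
  app  : ∀ {Γ A B} → Γ ⊢ A ⇒ B → Γ ⊢ A → Γ ⊢ B
  shut : ∀ {Γ A} → Γ ▸🔒 ⊢ A → Γ ⊢ □ A
  opn  : ∀ {Γ Γ' A} → Γ ⊢ □ A → (w : Γ ≼ Γ') → Γ' ⊢ A

infix 4 _⊆_
data _⊆_ : Ctx → Ctx → Set where
  base   : ∙ ⊆ ∙
  keep   : ∀ {Γ Δ A} → Γ ⊆ Δ → Γ ▸ A ⊆ Δ ▸ A
  drop   : ∀ {Γ Δ A} → Γ ⊆ Δ → Γ ⊆ Δ ▸ A
  keep🔒 : ∀ {Γ Δ} → Γ ⊆ Δ → Γ ▸🔒 ⊆ Δ ▸🔒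
  drop🔒 : ∀ {Γ Δ} → Γ ⊆ Δ → Γ ⊆ Δ ▸🔒

⊆-refl : ∀ {Γ} → Γ ⊆ Γ
⊆-refl {∙}     = base
⊆-refl {Γ ▸ A} = keep ⊆-refl
⊆-refl {Γ ▸🔒} = keep🔒 ⊆-refl

del : ∀ Γ Δ Γ₁ → Γ ,, Γ₁ ⊆ (Γ ,, Δ) ,, Γ₁
del Γ Δ       (Γ₁ ▸ A) = keep (del Γ Δ Γ₁)
del Γ Δ       (Γ₁ ▸🔒) = keep🔒 (del Γ Δ Γ₁)
del Γ ∙       ∙        = ⊆-refl
del Γ (Δ ▸ A) ∙        = drop (del Γ Δ ∙)
del Γ (Δ ▸🔒) ∙        = drop🔒 (del Γ Δ ∙)

strVar : ∀ {Γs Γ A} → Γs ⊆ Γ → Var Γ A → Maybe (Var Γs A)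
strVar (keep θ) vz     = just vz
strVar (keep θ) (vs v) = mapMaybe vs (strVar θ v)
strVar (drop θ) vz     = nothing
strVar (drop θ) (vs v) = strVar θ v

-- restricting a deletion to the premise of an open rule:
-- deleting entries from Γ' = Γa , Γ₀ deletes entries from Γa and from Γ₀
split : ∀ {Γs Γ' Γa} → Γs ⊆ Γ' → Γa ≼ Γ' → Σ Ctx λ Γa' → (Γa' ⊆ Γa) × (Γa' ≼ Γs)
split θ          ≼-refl     = _ , θ , ≼-refl
split (keep θ)   (≼-var w)  = let (Γa' , θa , w') = split θ w in Γa' , θa , ≼-var w'
split (drop θ)   (≼-var w)  = split θ w
split (keep🔒 θ) (≼-lock w) = let (Γa' , θa , w') = split θ w in Γa' , θa , ≼-lock w'
split (drop🔒 θ) (≼-lock w) = split θ w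

-- "no deleted variable is free in t"
Avoids : ∀ {Γs Γ A} → Γs ⊆ Γ → Γ ⊢ A → Set
Avoids θ (var v)    = T (is-just (strVar θ v))
Avoids θ unit       = ⊤
Avoids θ (pair t u) = Avoids θ t × Avoids θ u
Avoids θ (fst t)    = Avoids θ t
Avoids θ (snd t)    = Avoids θ t
Avoids θ (lam t)    = Avoids (keep θ) t
Avoids θ (app t u)  = Avoids θ t × Avoids θ u
Avoids θ (shut t)   = Avoids (keep🔒 θ) t
Avoids θ (opn t w)  = Avoids (proj₁ (proj₂ (split θ w))) t

strengthen : ∀ {Γs Γ A} (θ : Γs ⊆ Γ) (t : Γ ⊢ A) → Avoids θ t → Γs ⊢ A
strengthen θ (var v)    a       = var (to-witness-T (strVar θ v) a)
strengthen θ unit       a       = unit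
strengthen θ (pair t u) (a , b) = pair (strengthen θ t a) (strengthen θ u b)
strengthen θ (fst t)    a       = fst (strengthen θ t a)
strengthen θ (snd t)    a       = snd (strengthen θ t a)
strengthen θ (lam t)    a       = lam (strengthen (keep θ) t a)
strengthen θ (app t u)  (a , b) = app (strengthen θ t a) (strengthen θ u b)
strengthen θ (shut t)   a       = shut (strengthen (keep🔒 θ) t a)
strengthen θ (opn t w)  a       =
  opn (strengthen (proj₁ (proj₂ (split θ w))) t a) (proj₂ (proj₂ (split θ w)))

module Semantics {o ℓ e} (M : Model o ℓ e) (⟦p⟧ : ℕ → Model.Obj M) where
  open Model M

  -- the monad (◇, η, μ) induced by the comonad □ via ◇ ⊣ □
  η : ∀ {X} → Hom X (◇₀ X)
  η {X} = ε {◇₀ X} ∘ ηᵐ {X}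

  μ : ∀ {X} → Hom (◇₀ (◇₀ X)) (◇₀ X)
  μ {X} = εᵐ {◇₀ X} ∘ ◇₁ (εᵐ {□₀ (◇₀ X)} ∘ ◇₁ (δ {◇₀ X} ∘ ηᵐ {X}))

  ⟦_⟧ty : Ty → Obj
  ⟦ atom p ⟧ty = ⟦p⟧ p
  ⟦ 𝟙 ⟧ty      = ⊤ₒ
  ⟦ A ⊗ B ⟧ty  = ⟦ A ⟧ty ×ₒ ⟦ B ⟧ty
  ⟦ A ⇒ B ⟧ty  = ⟦ A ⟧ty ⇨ ⟦ B ⟧ty
  ⟦ □ A ⟧ty    = □₀ ⟦ A ⟧ty

  ⟦_⟧ctx : Ctx → Obj
  ⟦ ∙ ⟧ctx     = ⊤ₒ
  ⟦ Γ ▸ A ⟧ctx = ⟦ Γ ⟧ctx ×ₒ ⟦ A ⟧ty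
  ⟦ Γ ▸🔒 ⟧ctx = ◇₀ ⟦ Γ ⟧ctx

  lock : ∀ {Γ Γ'} → Γ ≼ Γ' → Hom ⟦ Γ' ⟧ctx (◇₀ ⟦ Γ ⟧ctx)
  lock ≼-refl     = η
  lock (≼-var w)  = lock w ∘ π₁
  lock (≼-lock w) = μ ∘ ◇₁ (lock w)

  ⟦_⟧var : ∀ {Γ A} → Var Γ A → Hom ⟦ Γ ⟧ctx ⟦ A ⟧ty
  ⟦ vz ⟧var   = π₂
  ⟦ vs v ⟧var = ⟦ v ⟧var ∘ π₁

  ⟦_⟧ : ∀ {Γ A} → Γ ⊢ A → Hom ⟦ Γ ⟧ctx ⟦ A ⟧ty
  ⟦ var v ⟧    = ⟦ v ⟧var
  ⟦ unit ⟧     = !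
  ⟦ pair t u ⟧ = ⟨ ⟦ t ⟧ , ⟦ u ⟧ ⟩
  ⟦ fst t ⟧    = π₁ ∘ ⟦ t ⟧
  ⟦ snd t ⟧    = π₂ ∘ ⟦ t ⟧
  ⟦ lam t ⟧    = curry ⟦ t ⟧
  ⟦ app t u ⟧  = eval ∘ ⟨ ⟦ t ⟧ , ⟦ u ⟧ ⟩
  ⟦ shut t ⟧   = □₁ ⟦ t ⟧ ∘ ηᵐ
  ⟦ opn t w ⟧  = εᵐ ∘ (◇₁ ⟦ t ⟧ ∘ lock w)

-- Strengthening cannot be interpreted by a map ⟦Γ , Γ'⟧ → ⟦Γ⟧, since there is no map ◇X → X
-- for a deleted lock.  Instead both ⟦Γ , Γ'⟧ and ⟦Γ⟧ are mapped into an intermediate object Q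
-- that keeps a ◇ for every deleted lock: projecting from the big context, inserting η from the
-- small one.  By induction on derivations, ⟦D⟧ and ⟦D'⟧ factor through Q via one common map.
-- After applying ◇, the two maps into Q differ exactly by the lock replacement of Γ' followed
-- by μ; this uses idempotence (◇η ∘ μ = id) to cancel the η's.  Composing the lock replacements
-- (μ associative and natural) turns ⟦E⟧ into ⟦E'⟧.

module Submission where

open import Defs
open import Level using (Level; _⊔_)
open import Data.Nat using (ℕ)
open import Data.Product using (_,_; proj₁; proj₂)
open import Data.Maybe using (just; is-just; to-witness-T)
open import Data.Bool using (T)
open import Data.Unit using (tt)
open import Relation.Binary using (Setoid; IsEquivalence)
import Relation.Binary.Reasoning.Setoid as SetoidReasoning

module HomReasoning {o ℓ e} (M : Model o ℓ e) where
  open Model M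

  hom-setoid : Obj → Obj → Setoid ℓ e
  hom-setoid X Y = record { isEquivalence = ≈-equiv {X} {Y} }

  open module HomEq {X Y : Obj} = IsEquivalence (≈-equiv {X} {Y}) public
    using () renaming (refl to ≈-refl; sym to ≈-sym; trans to ≈-trans)
  open module HomR {X Y : Obj} = SetoidReasoning (hom-setoid X Y) public
    using (begin_; _∎; step-≈-⟩; step-≈-⟨)

  infixr 4 _⟩∘⟨_ refl⟩∘⟨_
  infixl 5 _⟩∘⟨refl

  _⟩∘⟨_ : ∀ {X Y Z} {f f' : Hom Y Z} {g g' : Hom X Y} → f ≈ f' → g ≈ g' → f ∘ g ≈ f' ∘ g'
  _⟩∘⟨_ = ∘-resp-≈

  refl⟩∘⟨_ : ∀ {X Y Z} {f : Hom Y Z} {g g' : Hom X Y} → g ≈ g' → f ∘ g ≈ f ∘ g'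
  refl⟩∘⟨ p = ≈-refl ⟩∘⟨ p

  _⟩∘⟨refl : ∀ {X Y Z} {f f' : Hom Y Z} {g : Hom X Y} → f ≈ f' → f ∘ g ≈ f' ∘ g
  p ⟩∘⟨refl = p ⟩∘⟨ ≈-refl

  sym-assoc : ∀ {W X Y Z} {f : Hom Y Z} {g : Hom X Y} {h : Hom W X} → f ∘ (g ∘ h) ≈ (f ∘ g) ∘ h
  sym-assoc = ≈-sym assoc

  pullˡ : ∀ {W X Y Z} {f : Hom Y Z} {g : Hom X Y} {i : Hom X Z} {h : Hom W X} →
          f ∘ g ≈ i → f ∘ (g ∘ h) ≈ i ∘ h
  pullˡ p = ≈-trans sym-assoc (p ⟩∘⟨refl)

  pullʳ : ∀ {W X Y Z} {f : Hom Y Z} {g : Hom X Y} {h : Hom W X} {i : Hom W Y} →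
          g ∘ h ≈ i → (f ∘ g) ∘ h ≈ f ∘ i
  pullʳ p = ≈-trans assoc (refl⟩∘⟨ p)

module CartesianClosed {o ℓ e} (M : Model o ℓ e) where
  open Model M
  open HomReasoning M

  ⟨⟩∘ : ∀ {V W X Y} {f : Hom W X} {g : Hom W Y} {h : Hom V W} →
        ⟨ f , g ⟩ ∘ h ≈ ⟨ f ∘ h , g ∘ h ⟩
  ⟨⟩∘ = ⟨⟩-unique (pullˡ π₁-β) (pullˡ π₂-β)

  ⟨⟩-resp-≈ : ∀ {W X Y} {f f' : Hom W X} {g g' : Hom W Y} →
              f ≈ f' → g ≈ g' → ⟨ f , g ⟩ ≈ ⟨ f' , g' ⟩
  ⟨⟩-resp-≈ p q = ⟨⟩-unique (≈-trans π₁-β p) (≈-trans π₂-β q)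

  curry-resp-≈ : ∀ {X Y Z} {f f' : Hom (X ×ₒ Y) Z} → f ≈ f' → curry f ≈ curry f'
  curry-resp-≈ p = curry-unique (≈-trans eval-curry p)

  curry∘ : ∀ {W X Y Z} {h : Hom (X ×ₒ Y) Z} {f : Hom W X} →
           curry h ∘ f ≈ curry (h ∘ ⟨ f ∘ π₁ , π₂ ⟩)
  curry∘ {h = h} {f} = curry-unique (begin
    eval ∘ ⟨ (curry h ∘ f) ∘ π₁ , π₂ ⟩
      ≈⟨ refl⟩∘⟨ ⟨⟩-resp-≈ (≈-trans (pullʳ (≈-sym π₁-β)) sym-assoc) (≈-sym π₂-β) ⟩
    eval ∘ ⟨ (curry h ∘ π₁) ∘ ⟨ f ∘ π₁ , π₂ ⟩ , π₂ ∘ ⟨ f ∘ π₁ , π₂ ⟩ ⟩ ≈⟨ refl⟩∘⟨ ⟨⟩∘ ⟨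
    eval ∘ (⟨ curry h ∘ π₁ , π₂ ⟩ ∘ ⟨ f ∘ π₁ , π₂ ⟩)                     ≈⟨ pullˡ eval-curry ⟩
    h ∘ ⟨ f ∘ π₁ , π₂ ⟩                                                   ∎)

module ◇-Monad {o ℓ e} (M : Model o ℓ e) (⟦p⟧ : ℕ → Model.Obj M) where
  open Model M
  open Semantics M ⟦p⟧
  open HomReasoning M

  ♭ : ∀ {X Y} → Hom X (□₀ Y) → Hom (◇₀ X) Y
  ♭ g = εᵐ ∘ ◇₁ g

  ♭-resp-≈ : ∀ {X Y} {g g' : Hom X (□₀ Y)} → g ≈ g' → ♭ g ≈ ♭ g'
  ♭-resp-≈ p = refl⟩∘⟨ ◇-resp-≈ p

  ♭-∘ʳ : ∀ {W X Y} {g : Hom X (□₀ Y)} {h : Hom W X} → ♭ (g ∘ h) ≈ ♭ g ∘ ◇₁ h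
  ♭-∘ʳ = ≈-trans (refl⟩∘⟨ ◇-hom) sym-assoc

  ♭-∘ˡ : ∀ {X Y Z} {f : Hom Y Z} {g : Hom X (□₀ Y)} → ♭ (□₁ f ∘ g) ≈ f ∘ ♭ g
  ♭-∘ˡ {f = f} {g} = begin
    ♭ (□₁ f ∘ g)            ≈⟨ ♭-∘ʳ ⟩
    (εᵐ ∘ ◇₁ (□₁ f)) ∘ ◇₁ g ≈⟨ εᵐ-natural ⟩∘⟨refl ⟩
    (f ∘ εᵐ) ∘ ◇₁ g         ≈⟨ assoc ⟩
    f ∘ ♭ g                 ∎

  □♭∘ηᵐ : ∀ {X Y} {g : Hom X (□₀ Y)} → □₁ (♭ g) ∘ ηᵐ ≈ g
  □♭∘ηᵐ {g = g} = begin
    □₁ (εᵐ ∘ ◇₁ g) ∘ ηᵐ        ≈⟨ □-hom ⟩∘⟨refl ⟩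
    (□₁ εᵐ ∘ □₁ (◇₁ g)) ∘ ηᵐ   ≈⟨ pullʳ (≈-sym ηᵐ-natural) ⟩
    □₁ εᵐ ∘ (ηᵐ ∘ g)           ≈⟨ pullˡ zag ⟩
    id ∘ g                     ≈⟨ identityˡ ⟩
    g                          ∎

  ♭∘η : ∀ {X Y} {g : Hom X (□₀ Y)} → ♭ g ∘ η ≈ ε ∘ g
  ♭∘η {g = g} = begin
    ♭ g ∘ (ε ∘ ηᵐ)            ≈⟨ sym-assoc ⟩
    (♭ g ∘ ε) ∘ ηᵐ            ≈⟨ ε-natural ⟩∘⟨refl ⟩
    (ε ∘ □₁ (♭ g)) ∘ ηᵐ       ≈⟨ pullʳ □♭∘ηᵐ ⟩
    ε ∘ g                     ∎

  η-natural : ∀ {X Y} {f : Hom X Y} → η ∘ f ≈ ◇₁ f ∘ η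
  η-natural {f = f} = begin
    (ε ∘ ηᵐ) ∘ f              ≈⟨ pullʳ ηᵐ-natural ⟩
    ε ∘ (□₁ (◇₁ f) ∘ ηᵐ)      ≈⟨ pullˡ (≈-sym ε-natural) ⟩
    (◇₁ f ∘ ε) ∘ ηᵐ           ≈⟨ assoc ⟩
    ◇₁ f ∘ η                  ∎

  -- κ is the □-coalgebra structure of ◇X, and μ = ♭ κ by definition.
  κ : ∀ {X} → Hom (◇₀ X) (□₀ (◇₀ X))
  κ = ♭ (δ ∘ ηᵐ)

  δ∘ηᵐ-natural : ∀ {X Y} {f : Hom X Y} → (δ ∘ ηᵐ) ∘ f ≈ □₁ (□₁ (◇₁ f)) ∘ (δ ∘ ηᵐ)
  δ∘ηᵐ-natural {f = f} = begin
    (δ ∘ ηᵐ) ∘ f                 ≈⟨ pullʳ ηᵐ-natural ⟩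
    δ ∘ (□₁ (◇₁ f) ∘ ηᵐ)         ≈⟨ pullˡ (≈-sym δ-natural) ⟩
    (□₁ (□₁ (◇₁ f)) ∘ δ) ∘ ηᵐ    ≈⟨ assoc ⟩
    □₁ (□₁ (◇₁ f)) ∘ (δ ∘ ηᵐ)    ∎

  κ-natural : ∀ {X Y} {f : Hom X Y} → κ ∘ ◇₁ f ≈ □₁ (◇₁ f) ∘ κ
  κ-natural {f = f} = begin
    ♭ (δ ∘ ηᵐ) ∘ ◇₁ f               ≈⟨ ♭-∘ʳ ⟨
    ♭ ((δ ∘ ηᵐ) ∘ f)                ≈⟨ ♭-resp-≈ δ∘ηᵐ-natural ⟩
    ♭ (□₁ (□₁ (◇₁ f)) ∘ (δ ∘ ηᵐ))   ≈⟨ ♭-∘ˡ ⟩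
    □₁ (◇₁ f) ∘ κ                   ∎

  ε∘κ≈id : ∀ {X} → ε ∘ κ {X} ≈ id
  ε∘κ≈id = begin
    ε ∘ ♭ (δ ∘ ηᵐ)           ≈⟨ ♭-∘ˡ ⟨
    ♭ (□₁ ε ∘ (δ ∘ ηᵐ))      ≈⟨ ♭-resp-≈ (≈-trans (pullˡ comonad-idʳ) identityˡ) ⟩
    ♭ ηᵐ                     ≈⟨ zig ⟩
    id                       ∎

  □κ∘κ≈δ∘κ : ∀ {X} → □₁ (κ {X}) ∘ κ ≈ δ ∘ κ
  □κ∘κ≈δ∘κ = begin
    □₁ κ ∘ ♭ (δ ∘ ηᵐ)             ≈⟨ ♭-∘ˡ ⟨
    ♭ (□₁ (□₁ κ) ∘ (δ ∘ ηᵐ))      ≈⟨ ♭-resp-≈ (pullˡ δ-natural) ⟩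
    ♭ ((δ ∘ □₁ κ) ∘ ηᵐ)           ≈⟨ ♭-resp-≈ (pullʳ □♭∘ηᵐ) ⟩
    ♭ (δ ∘ (δ ∘ ηᵐ))              ≈⟨ ♭-resp-≈ (≈-trans (pullˡ comonad-assoc) assoc) ⟩
    ♭ (□₁ δ ∘ (δ ∘ ηᵐ))           ≈⟨ ♭-∘ˡ ⟩
    δ ∘ κ                         ∎

  μ-natural : ∀ {X Y} {f : Hom X Y} → μ ∘ ◇₁ (◇₁ f) ≈ ◇₁ f ∘ μ
  μ-natural {f = f} = begin
    ♭ κ ∘ ◇₁ (◇₁ f)        ≈⟨ ♭-∘ʳ ⟨
    ♭ (κ ∘ ◇₁ f)           ≈⟨ ♭-resp-≈ κ-natural ⟩
    ♭ (□₁ (◇₁ f) ∘ κ)      ≈⟨ ♭-∘ˡ ⟩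
    ◇₁ f ∘ μ               ∎

  μ∘η≈id : ∀ {X} → μ {X} ∘ η ≈ id
  μ∘η≈id = ≈-trans ♭∘η ε∘κ≈id

  μ∘◇η≈id : ∀ {X} → μ {X} ∘ ◇₁ η ≈ id
  μ∘◇η≈id = begin
    ♭ κ ∘ ◇₁ η       ≈⟨ ♭-∘ʳ ⟨
    ♭ (κ ∘ η)        ≈⟨ ♭-resp-≈ (≈-trans ♭∘η (≈-trans (pullˡ comonad-idˡ) identityˡ)) ⟩
    ♭ ηᵐ             ≈⟨ zig ⟩
    id               ∎

  κ∘μ≈□μ∘κ : ∀ {X} → κ ∘ μ {X} ≈ □₁ μ ∘ κ
  κ∘μ≈□μ∘κ = begin
    κ ∘ ♭ κ                      ≈⟨ ♭-∘ˡ ⟨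
    ♭ (□₁ κ ∘ κ)                 ≈⟨ ♭-resp-≈ □κ∘κ≈δ∘κ ⟩
    ♭ (δ ∘ κ)                    ≈⟨ ♭-resp-≈ (refl⟩∘⟨ □♭∘ηᵐ) ⟨
    ♭ (δ ∘ (□₁ μ ∘ ηᵐ))          ≈⟨ ♭-resp-≈ sym-assoc ⟩
    ♭ ((δ ∘ □₁ μ) ∘ ηᵐ)          ≈⟨ ♭-resp-≈ (pullˡ δ-natural) ⟨
    ♭ (□₁ (□₁ μ) ∘ (δ ∘ ηᵐ))     ≈⟨ ♭-∘ˡ ⟩
    □₁ μ ∘ κ                     ∎

  μ-assoc : ∀ {X} → μ {X} ∘ ◇₁ μ ≈ μ ∘ μ
  μ-assoc = begin
    ♭ κ ∘ ◇₁ μ        ≈⟨ ♭-∘ʳ ⟨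
    ♭ (κ ∘ μ)         ≈⟨ ♭-resp-≈ κ∘μ≈□μ∘κ ⟩
    ♭ (□₁ μ ∘ κ)      ≈⟨ ♭-∘ˡ ⟩
    μ ∘ μ             ∎

  -- ε is a left inverse of δ, which idempotence makes invertible; so ε is its inverse.
  δ∘ε≈id : ∀ {X} → δ {X} ∘ ε ≈ id
  δ∘ε≈id {X} with δ-iso {X}
  ... | g , _ , δ∘g≈id = begin
    δ ∘ ε                ≈⟨ refl⟩∘⟨ identityʳ ⟨
    δ ∘ (ε ∘ id)         ≈⟨ refl⟩∘⟨ refl⟩∘⟨ δ∘g≈id ⟨
    δ ∘ (ε ∘ (δ ∘ g))    ≈⟨ refl⟩∘⟨ ≈-trans (pullˡ comonad-idˡ) identityˡ ⟩
    δ ∘ g                ≈⟨ δ∘g≈id ⟩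
    id                   ∎

  □◇η∘κ≈ηᵐ : ∀ {X} → □₁ (◇₁ (η {X})) ∘ κ ≈ ηᵐ
  □◇η∘κ≈ηᵐ = begin
    □₁ (◇₁ η) ∘ ♭ (δ ∘ ηᵐ)           ≈⟨ ♭-∘ˡ ⟨
    ♭ (□₁ (□₁ (◇₁ η)) ∘ (δ ∘ ηᵐ))    ≈⟨ ♭-resp-≈ δ∘ηᵐ-natural ⟨
    ♭ ((δ ∘ ηᵐ) ∘ (ε ∘ ηᵐ))          ≈⟨ ♭-resp-≈ (pullʳ (pullˡ ε-natural)) ⟩
    ♭ (δ ∘ ((ε ∘ □₁ ηᵐ) ∘ ηᵐ))       ≈⟨ ♭-resp-≈ (≈-trans (refl⟩∘⟨ assoc) (pullˡ δ∘ε≈id)) ⟩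
    ♭ (id ∘ (□₁ ηᵐ ∘ ηᵐ))            ≈⟨ ♭-resp-≈ identityˡ ⟩
    ♭ (□₁ ηᵐ ∘ ηᵐ)                   ≈⟨ ♭-∘ˡ ⟩
    ηᵐ ∘ ♭ ηᵐ                        ≈⟨ refl⟩∘⟨ zig ⟩
    ηᵐ ∘ id                          ≈⟨ identityʳ ⟩
    ηᵐ                               ∎

  ◇η∘μ≈id : ∀ {X} → ◇₁ (η {X}) ∘ μ ≈ id
  ◇η∘μ≈id = begin
    ◇₁ η ∘ ♭ κ             ≈⟨ ♭-∘ˡ ⟨
    ♭ (□₁ (◇₁ η) ∘ κ)      ≈⟨ ♭-resp-≈ □◇η∘κ≈ηᵐ ⟩
    ♭ ηᵐ                   ≈⟨ zig ⟩
    id                     ∎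

  μ∘◇[◇f∘g] : ∀ {X Y Z} {f : Hom Y Z} {g : Hom X (◇₀ Y)} →
              μ ∘ ◇₁ (◇₁ f ∘ g) ≈ ◇₁ f ∘ (μ ∘ ◇₁ g)
  μ∘◇[◇f∘g] = ≈-trans (refl⟩∘⟨ ◇-hom) (≈-trans (pullˡ μ-natural) assoc)

  lock-≼-trans : ∀ {Γ Δ Θ} (w : Γ ≼ Δ) (v : Δ ≼ Θ) →
                 lock (≼-trans w v) ≈ μ ∘ (◇₁ (lock w) ∘ lock v)
  lock-≼-trans w ≼-refl = begin
    lock w                    ≈⟨ identityˡ ⟨
    id ∘ lock w               ≈⟨ pullˡ μ∘η≈id ⟨
    μ ∘ (η ∘ lock w)          ≈⟨ refl⟩∘⟨ η-natural ⟩
    μ ∘ (◇₁ (lock w) ∘ η)     ∎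
  lock-≼-trans w (≼-var v) =
    ≈-trans (lock-≼-trans w v ⟩∘⟨refl) (pullʳ assoc)
  lock-≼-trans w (≼-lock v) = begin
    μ ∘ ◇₁ (lock (≼-trans w v))                    ≈⟨ refl⟩∘⟨ ◇-resp-≈ (lock-≼-trans w v) ⟩
    μ ∘ ◇₁ (μ ∘ (◇₁ (lock w) ∘ lock v))            ≈⟨ refl⟩∘⟨ ◇-hom ⟩
    μ ∘ (◇₁ μ ∘ ◇₁ (◇₁ (lock w) ∘ lock v))         ≈⟨ pullˡ μ-assoc ⟩
    (μ ∘ μ) ∘ ◇₁ (◇₁ (lock w) ∘ lock v)            ≈⟨ pullʳ μ∘◇[◇f∘g] ⟩
    μ ∘ (◇₁ (lock w) ∘ (μ ∘ ◇₁ (lock v)))          ∎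

module SemanticStrengthening {o ℓ e} (M : Model o ℓ e) (⟦p⟧ : ℕ → Model.Obj M) where
  open Model M
  open Semantics M ⟦p⟧
  open HomReasoning M
  open CartesianClosed M
  open ◇-Monad M ⟦p⟧

  Q : ∀ {Γs Γ} → Γs ⊆ Γ → Obj
  Q base             = ⊤ₒ
  Q (keep {A = A} θ) = Q θ ×ₒ ⟦ A ⟧ty
  Q (drop θ)         = Q θ
  Q (keep🔒 θ)       = ◇₀ (Q θ)
  Q (drop🔒 θ)       = ◇₀ (Q θ)

  q : ∀ {Γs Γ} (θ : Γs ⊆ Γ) → Hom ⟦ Γ ⟧ctx (Q θ)
  q base       = id
  q (keep θ)   = ⟨ q θ ∘ π₁ , π₂ ⟩
  q (drop θ)   = q θ ∘ π₁
  q (keep🔒 θ) = ◇₁ (q θ)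
  q (drop🔒 θ) = ◇₁ (q θ)

  j : ∀ {Γs Γ} (θ : Γs ⊆ Γ) → Hom ⟦ Γs ⟧ctx (Q θ)
  j base       = id
  j (keep θ)   = ⟨ j θ ∘ π₁ , π₂ ⟩
  j (drop θ)   = j θ
  j (keep🔒 θ) = ◇₁ (j θ)
  j (drop🔒 θ) = η ∘ j θ

  record Factors {Γs Γ X} (θ : Γs ⊆ Γ) (f : Hom ⟦ Γ ⟧ctx X) (g : Hom ⟦ Γs ⟧ctx X)
                 : Set (ℓ ⊔ e) where
    field
      mid   : Hom (Q θ) X
      via-q : f ≈ mid ∘ q θ
      via-j : mid ∘ j θ ≈ g

    ◇-via-q : ∀ {Z} {l : Hom Z (◇₀ ⟦ Γ ⟧ctx)} → ◇₁ f ∘ l ≈ ◇₁ mid ∘ (◇₁ (q θ) ∘ l)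
    ◇-via-q = ≈-trans (≈-trans (◇-resp-≈ via-q) ◇-hom ⟩∘⟨refl) assoc

    ◇-via-j : ∀ {Z} {l : Hom Z (◇₀ ⟦ Γs ⟧ctx)} → ◇₁ mid ∘ (◇₁ (j θ) ∘ l) ≈ ◇₁ g ∘ l
    ◇-via-j = ≈-trans sym-assoc (≈-trans (≈-sym ◇-hom) (◇-resp-≈ via-j) ⟩∘⟨refl)

  open Factors

  module _ {Γs Γ X} {θ : Γs ⊆ Γ} {f : Hom ⟦ Γ ⟧ctx X} {g : Hom ⟦ Γs ⟧ctx X} where

    factors-resp-≈ : ∀ {f' g'} → f ≈ f' → g ≈ g' → Factors θ f g → Factors θ f' g'
    factors-resp-≈ p r F = record
      { mid = mid F ; via-q = ≈-trans (≈-sym p) (via-q F) ; via-j = ≈-trans (via-j F) r }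

    factors-∘ : ∀ {Y} (h : Hom X Y) → Factors θ f g → Factors θ (h ∘ f) (h ∘ g)
    factors-∘ h F = record
      { mid = h ∘ mid F
      ; via-q = ≈-trans (refl⟩∘⟨ via-q F) sym-assoc
      ; via-j = ≈-trans assoc (refl⟩∘⟨ via-j F)
      }

    factors-⟨⟩ : ∀ {Y f' g'} → Factors θ f g → Factors {X = Y} θ f' g' →
                 Factors θ ⟨ f , f' ⟩ ⟨ g , g' ⟩
    factors-⟨⟩ F F' = record
      { mid = ⟨ mid F , mid F' ⟩
      ; via-q = ≈-trans (⟨⟩-resp-≈ (via-q F) (via-q F')) (≈-sym ⟨⟩∘)
      ; via-j = ≈-trans ⟨⟩∘ (⟨⟩-resp-≈ (via-j F) (via-j F'))
      }

    factors-keep : ∀ {A} → Factors θ f g → Factors (keep {A = A} θ) (f ∘ π₁) (g ∘ π₁)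
    factors-keep F = record
      { mid = mid F ∘ π₁
      ; via-q = ≈-trans (via-q F ⟩∘⟨refl) (≈-trans (pullʳ (≈-sym π₁-β)) sym-assoc)
      ; via-j = ≈-trans (pullʳ π₁-β) (≈-trans sym-assoc (via-j F ⟩∘⟨refl))
      }

    factors-drop : ∀ {A} → Factors θ f g → Factors (drop {A = A} θ) (f ∘ π₁) g
    factors-drop F = record
      { mid = mid F ; via-q = ≈-trans (via-q F ⟩∘⟨refl) assoc ; via-j = via-j F }

    factors-keep🔒 : Factors θ f g → Factors (keep🔒 θ) (◇₁ f) (◇₁ g)
    factors-keep🔒 F = record
      { mid = ◇₁ (mid F)
      ; via-q = ≈-trans (◇-resp-≈ (via-q F)) ◇-hom
      ; via-j = ≈-trans (≈-sym ◇-hom) (◇-resp-≈ (via-j F))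
      }

    factors-drop🔒 : Factors θ f g → Factors (drop🔒 θ) (◇₁ f) (η ∘ g)
    factors-drop🔒 F = record
      { mid = ◇₁ (mid F)
      ; via-q = ≈-trans (◇-resp-≈ (via-q F)) ◇-hom
      ; via-j = ≈-trans (pullˡ (≈-sym η-natural)) (pullʳ (via-j F))
      }

  factors-! : ∀ {Γs Γ} {θ : Γs ⊆ Γ} → Factors θ ! !
  factors-! = record { mid = ! ; via-q = ≈-sym (!-unique _) ; via-j = !-unique _ }

  factors-curry : ∀ {Γs Γ A Z} {θ : Γs ⊆ Γ} {f : Hom (⟦ Γ ⟧ctx ×ₒ ⟦ A ⟧ty) Z} {g} →
                  Factors (keep {A = A} θ) f g → Factors θ (curry f) (curry g)
  factors-curry F = record
    { mid = curry (mid F)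
    ; via-q = ≈-trans (curry-resp-≈ (via-q F)) (≈-sym curry∘)
    ; via-j = ≈-trans curry∘ (curry-resp-≈ (via-j F))
    }

  factors-shut : ∀ {Γs Γ Z} {θ : Γs ⊆ Γ} {f : Hom (◇₀ ⟦ Γ ⟧ctx) Z} {g} →
                 Factors (keep🔒 θ) f g → Factors θ (□₁ f ∘ ηᵐ) (□₁ g ∘ ηᵐ)
  factors-shut {θ = θ} F = record
    { mid = □₁ (mid F) ∘ ηᵐ
    ; via-q = ≈-trans (□-resp-≈ (via-q F) ⟩∘⟨refl) (□[h∘◇x]∘ηᵐ (q θ))
    ; via-j = ≈-trans (≈-sym (□[h∘◇x]∘ηᵐ (j θ))) (□-resp-≈ (via-j F) ⟩∘⟨refl)
    }
    where
    □[h∘◇x]∘ηᵐ : ∀ {Y} (x : Hom Y (Q θ)) → □₁ (mid F ∘ ◇₁ x) ∘ ηᵐ ≈ (□₁ (mid F) ∘ ηᵐ) ∘ x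
    □[h∘◇x]∘ηᵐ x = ≈-trans (□-hom ⟩∘⟨refl) (≈-trans (pullʳ (≈-sym ηᵐ-natural)) sym-assoc)

  factors-opn : ∀ {Γs Γ Γsa Γa Z} {θ : Γs ⊆ Γ} {θa : Γsa ⊆ Γa}
                  {f : Hom ⟦ Γa ⟧ctx (□₀ Z)} {g : Hom ⟦ Γsa ⟧ctx (□₀ Z)}
                  {l : Hom ⟦ Γ ⟧ctx (◇₀ ⟦ Γa ⟧ctx)} {l' : Hom ⟦ Γs ⟧ctx (◇₀ ⟦ Γsa ⟧ctx)} →
                Factors θa f g → Factors θ (◇₁ (q θa) ∘ l) (◇₁ (j θa) ∘ l') →
                Factors θ (εᵐ ∘ (◇₁ f ∘ l)) (εᵐ ∘ (◇₁ g ∘ l'))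
  factors-opn Fa L =
    factors-∘ εᵐ (factors-resp-≈ (≈-sym (◇-via-q Fa)) (◇-via-j Fa) (factors-∘ (◇₁ (mid Fa)) L))

  split-⊆ : ∀ {Γs Γ' Γa} (θ : Γs ⊆ Γ') (w : Γa ≼ Γ') → proj₁ (split θ w) ⊆ Γa
  split-⊆ θ w = proj₁ (proj₂ (split θ w))

  split-≼ : ∀ {Γs Γ' Γa} (θ : Γs ⊆ Γ') (w : Γa ≼ Γ') → proj₁ (split θ w) ≼ Γs
  split-≼ θ w = proj₂ (proj₂ (split θ w))

  factors-lock : ∀ {Γs Γ' Γa} (θ : Γs ⊆ Γ') (w : Γa ≼ Γ') →
                 Factors θ (◇₁ (q (split-⊆ θ w)) ∘ lock w) (◇₁ (j (split-⊆ θ w)) ∘ lock (split-≼ θ w))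
  factors-lock θ ≼-refl =
    record { mid = η ; via-q = ≈-sym η-natural ; via-j = η-natural }
  factors-lock (keep θ) (≼-var w) =
    factors-resp-≈ assoc assoc (factors-keep (factors-lock θ w))
  factors-lock (drop θ) (≼-var w) =
    factors-resp-≈ assoc ≈-refl (factors-drop (factors-lock θ w))
  factors-lock (keep🔒 θ) (≼-lock w) =
    factors-resp-≈ μ∘◇[◇f∘g] μ∘◇[◇f∘g] (factors-∘ μ (factors-keep🔒 (factors-lock θ w)))
  factors-lock (drop🔒 θ) (≼-lock w) =
    factors-resp-≈ μ∘◇[◇f∘g] (≈-trans (pullˡ μ∘η≈id) identityˡ)
      (factors-∘ μ (factors-drop🔒 (factors-lock θ w)))

  factors-var : ∀ {Γs Γ A} (θ : Γs ⊆ Γ) (v : Var Γ A) (a : T (is-just (strVar θ v))) →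
                Factors θ ⟦ v ⟧var ⟦ to-witness-T (strVar θ v) a ⟧var
  factors-var (keep θ) vz a = record { mid = π₂ ; via-q = ≈-sym π₂-β ; via-j = π₂-β }
  factors-var (keep θ) (vs v) a with strVar θ v | factors-var θ v
  ... | just v' | F = factors-keep (F tt)
  factors-var (drop θ) (vs v) a = factors-drop (factors-var θ v a)

  factors-⟦⟧ : ∀ {Γs Γ A} (θ : Γs ⊆ Γ) (t : Γ ⊢ A) (a : Avoids θ t) →
               Factors θ ⟦ t ⟧ ⟦ strengthen θ t a ⟧
  factors-⟦⟧ θ (var v)    a       = factors-var θ v a
  factors-⟦⟧ θ unit       a       = factors-!
  factors-⟦⟧ θ (pair t u) (a , b) = factors-⟨⟩ (factors-⟦⟧ θ t a) (factors-⟦⟧ θ u b)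
  factors-⟦⟧ θ (fst t)    a       = factors-∘ π₁ (factors-⟦⟧ θ t a)
  factors-⟦⟧ θ (snd t)    a       = factors-∘ π₂ (factors-⟦⟧ θ t a)
  factors-⟦⟧ θ (lam t)    a       = factors-curry (factors-⟦⟧ (keep θ) t a)
  factors-⟦⟧ θ (app t u)  (a , b) =
    factors-∘ eval (factors-⟨⟩ (factors-⟦⟧ θ t a) (factors-⟦⟧ θ u b))
  factors-⟦⟧ θ (shut t)   a       = factors-shut (factors-⟦⟧ (keep🔒 θ) t a)
  factors-⟦⟧ θ (opn t w)  a       =
    factors-opn (factors-⟦⟧ (split-⊆ θ w) t a) (factors-lock θ w)

  q≈j-⊆-refl : ∀ Γ → q (⊆-refl {Γ}) ≈ j (⊆-refl {Γ})
  q≈j-⊆-refl ∙       = ≈-refl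
  q≈j-⊆-refl (Γ ▸ A) = ⟨⟩-resp-≈ (q≈j-⊆-refl Γ ⟩∘⟨refl) ≈-refl
  q≈j-⊆-refl (Γ ▸🔒) = ◇-resp-≈ (q≈j-⊆-refl Γ)

  ◇q≈◇j∘μ∘◇lock : ∀ Γ Δ →
                  ◇₁ (q (del Γ Δ ∙)) ≈ ◇₁ (j (del Γ Δ ∙)) ∘ (μ ∘ ◇₁ (lock (≼-++ Γ Δ)))
  ◇q≈◇j∘μ∘◇lock Γ ∙ = begin
    ◇₁ (q (⊆-refl {Γ}))                  ≈⟨ ◇-resp-≈ (q≈j-⊆-refl Γ) ⟩
    ◇₁ (j (⊆-refl {Γ}))                  ≈⟨ identityʳ ⟨
    ◇₁ (j (⊆-refl {Γ})) ∘ id             ≈⟨ refl⟩∘⟨ μ∘◇η≈id ⟨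
    ◇₁ (j (⊆-refl {Γ})) ∘ (μ ∘ ◇₁ η)     ∎
  ◇q≈◇j∘μ∘◇lock Γ (Δ ▸ A) = begin
    ◇₁ (q θ ∘ π₁)                            ≈⟨ ◇-hom ⟩
    ◇₁ (q θ) ∘ ◇₁ π₁                         ≈⟨ ◇q≈◇j∘μ∘◇lock Γ Δ ⟩∘⟨refl ⟩
    (◇₁ (j θ) ∘ (μ ∘ ◇₁ l)) ∘ ◇₁ π₁          ≈⟨ pullʳ (pullʳ (≈-sym ◇-hom)) ⟩
    ◇₁ (j θ) ∘ (μ ∘ ◇₁ (l ∘ π₁))             ∎
    where
    θ = del Γ Δ ∙
    l = lock (≼-++ Γ Δ)
  ◇q≈◇j∘μ∘◇lock Γ (Δ ▸🔒) = begin
    ◇₁ (◇₁ (q θ))                            ≈⟨ identityˡ ⟨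
    id ∘ ◇₁ (◇₁ (q θ))                       ≈⟨ ◇η∘μ≈id ⟩∘⟨refl ⟨
    (◇₁ η ∘ μ) ∘ ◇₁ (◇₁ (q θ))               ≈⟨ pullʳ (refl⟩∘⟨ ◇-resp-≈ (◇q≈◇j∘μ∘◇lock Γ Δ)) ⟩
    ◇₁ η ∘ (μ ∘ ◇₁ (◇₁ (j θ) ∘ (μ ∘ ◇₁ l)))  ≈⟨ refl⟩∘⟨ μ∘◇[◇f∘g] ⟩
    ◇₁ η ∘ (◇₁ (j θ) ∘ (μ ∘ ◇₁ (μ ∘ ◇₁ l)))  ≈⟨ sym-assoc ⟩
    (◇₁ η ∘ ◇₁ (j θ)) ∘ (μ ∘ ◇₁ (μ ∘ ◇₁ l))  ≈⟨ ◇-hom ⟩∘⟨refl ⟨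
    ◇₁ (η ∘ j θ) ∘ (μ ∘ ◇₁ (μ ∘ ◇₁ l))       ∎
    where
    θ = del Γ Δ ∙
    l = lock (≼-++ Γ Δ)

  ◇q∘lock≈◇j∘lock : ∀ Γ Δ {Θ} (v : (Γ ,, Δ) ≼ Θ) →
                    ◇₁ (q (del Γ Δ ∙)) ∘ lock v ≈ ◇₁ (j (del Γ Δ ∙)) ∘ lock (≼-trans (≼-++ Γ Δ) v)
  ◇q∘lock≈◇j∘lock Γ Δ v = begin
    ◇₁ (q θ) ∘ lock v                          ≈⟨ ◇q≈◇j∘μ∘◇lock Γ Δ ⟩∘⟨refl ⟩
    (◇₁ (j θ) ∘ (μ ∘ ◇₁ (lock w))) ∘ lock v    ≈⟨ pullʳ assoc ⟩
    ◇₁ (j θ) ∘ (μ ∘ (◇₁ (lock w) ∘ lock v))    ≈⟨ refl⟩∘⟨ lock-≼-trans w v ⟨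
    ◇₁ (j θ) ∘ lock (≼-trans w v)              ∎
    where
    θ = del Γ Δ ∙
    w = ≼-++ Γ Δ

lemma10 : ∀ {o ℓ e : Level} (M : Model o ℓ e) (⟦p⟧ : ℕ → Model.Obj M)
            {Γ Γ' Γ'' : Ctx} {A : Ty}
            (D : Γ ,, Γ' ⊢ □ A) (noFree : Avoids (del Γ Γ' ∙) D) →
            Model._≈_ M
              (Semantics.⟦_⟧ M ⟦p⟧ (opn D (≼-++ (Γ ,, Γ') Γ'')))
              (Semantics.⟦_⟧ M ⟦p⟧
                (opn (strengthen (del Γ Γ' ∙) D noFree)
                     (≼-trans (≼-++ Γ Γ') (≼-++ (Γ ,, Γ') Γ''))))
lemma10 M ⟦p⟧ {Γ} {Γ'} {Γ''} D noFree = begin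
  εᵐ ∘ (◇₁ ⟦ D ⟧ ∘ lock v)                             ≈⟨ refl⟩∘⟨ ◇-via-q ⟩
  εᵐ ∘ (◇₁ mid ∘ (◇₁ (q θ) ∘ lock v))               ≈⟨ refl⟩∘⟨ refl⟩∘⟨ ◇q∘lock≈◇j∘lock Γ Γ' v ⟩
  εᵐ ∘ (◇₁ mid ∘ (◇₁ (j θ) ∘ lock (≼-trans w v)))   ≈⟨ refl⟩∘⟨ ◇-via-j ⟩
  εᵐ ∘ (◇₁ ⟦ strengthen θ D noFree ⟧ ∘ lock (≼-trans w v)) ∎
  where
  open Model M
  open Semantics M ⟦p⟧
  open HomReasoning M
  open SemanticStrengthening M ⟦p⟧
  θ = del Γ Γ' ∙
  w = ≼-++ Γ Γ'
  v = ≼-++ (Γ ,, Γ') Γ''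
  open Factors (factors-⟦⟧ θ D noFree)
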